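{- If $G$ is a finite simple graph and $H$ is a randomly matchable graph, then \[\phi_{gm}(G\circ H) \ge \phi_{gm}(G) + n(G)\,\phi_{gm}(H)+\frac{n(G)\,n(H)}{2}.\]
   Context: A graph is randomly matchable if every matching of it extends to a perfect matching (equivalently, every maximal matching is perfect). For a graph $X$, $n(X)$ is its number of vertices. A maximal matching is a matching not contained in any larger matching. A global forcing set for maximal matchings of $X$ is a set $S\subseteq E(X)$ such that $M_1\cap S\neq M_2\cap S$ for every two distinct maximal matchings $M_1,M_2$ of $X$; $\phi_{gm}(X)$ is the minimum size of such a set. The corona product $G\circ H$, where $V(G)=\{g_1,\dots,g_{n(G)}\}$, is obtained from the disjoint union of $G$ and $n(G)$ copies $H_1,\dots,H_{n(G)}$ of $H$ by joining, for each $i$, $g_i$ to every vertex of $H_i$. -}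

module Defs where

open import Data.Nat using (ℕ; zero; suc; _+_; _*_; _<ᵇ_)
open import Data.Fin using (Fin; toℕ; splitAt; remQuot; _≟_)
open import Data.Fin.Properties using ()
open import Data.List using (List; map)
open import Data.Nat.ListAction using (sum)
open import Data.Fin.Base using ()
open import Data.List using (allFin)
open import Data.Bool using (Bool; true; false; _∧_; if_then_else_)
open import Data.Bool.Properties using (∧-zeroʳ)
open import Data.Product using (Σ; _×_; _,_; ∃; proj₁; proj₂)
open import Data.Sum using (_⊎_; inj₁; inj₂)
open import Relation.Binary.PropositionalEquality using (_≡_; refl; sym; cong₂)
open import Relation.Nullary using (¬_; yes; no)
open import Relation.Nullary.Decidable using (⌊_⌋)
open import Data.Nat using (_<_)

record Graph : Set where
  field
    n     : ℕ
    adj   : Fin n → Fin n → Bool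
    adj-sym : ∀ i j → adj i j ≡ adj j i
    adj-irr : ∀ i → adj i i ≡ false
open Graph public

-- A set of edges of X, encoded as a Boolean function; the unordered pair {i,j}
-- with toℕ i < toℕ j is represented by the entry (i , j) (other entries ignored).
EdgeSet : Graph → Set
EdgeSet X = Fin (n X) → Fin (n X) → Bool

Mem : {X : Graph} → EdgeSet X → Fin (n X) → Fin (n X) → Set
Mem S i j = (toℕ i < toℕ j) × (S i j ≡ true)

SubE : (X : Graph) → EdgeSet X → Set
SubE X S = ∀ i j → Mem {X} S i j → adj X i j ≡ true

_⊆E_ : {X : Graph} → EdgeSet X → EdgeSet X → Set
_⊆E_ {X} S T = ∀ i j → Mem {X} S i j → Mem {X} T i j

SameE : {X : Graph} → EdgeSet X → EdgeSet X → Set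
SameE {X} S T = _⊆E_ {X} S T × _⊆E_ {X} T S

Share : {k : ℕ} → Fin k → Fin k → Fin k → Fin k → Set
Share a b c d = (a ≡ c) ⊎ (a ≡ d) ⊎ (b ≡ c) ⊎ (b ≡ d)

IsMatching : (X : Graph) → EdgeSet X → Set
IsMatching X M = SubE X M ×
  (∀ a b c d → Mem {X} M a b → Mem {X} M c d → Share a b c d → (a ≡ c) × (b ≡ d))

IsMaximalMatching : (X : Graph) → EdgeSet X → Set
IsMaximalMatching X M = IsMatching X M ×
  (∀ M' → IsMatching X M' → _⊆E_ {X} M M' → _⊆E_ {X} M' M)

IsPerfectMatching : (X : Graph) → EdgeSet X → Set
IsPerfectMatching X M = IsMatching X M ×
  (∀ v → ∃ λ u → Mem {X} M v u ⊎ Mem {X} M u v)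

RandomlyMatchable : Graph → Set
RandomlyMatchable X = ∀ M → IsMatching X M →
  Σ (EdgeSet X) λ P → IsPerfectMatching X P × _⊆E_ {X} M P

IsGlobalForcingSet : (X : Graph) → EdgeSet X → Set
IsGlobalForcingSet X S = SubE X S ×
  (∀ M₁ M₂ → IsMaximalMatching X M₁ → IsMaximalMatching X M₂ →
    (∀ i j → Mem {X} S i j → (Mem {X} M₁ i j → Mem {X} M₂ i j) × (Mem {X} M₂ i j → Mem {X} M₁ i j)) →
    SameE {X} M₁ M₂)

size : {X : Graph} → EdgeSet X → ℕ
size {X} S = sum (map (λ i → sum (map (λ j → if (toℕ i <ᵇ toℕ j) ∧ S i j then 1 else 0)
                                   (allFin (n X)))) (allFin (n X)))

IsPhiGm : Graph → ℕ → Set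
IsPhiGm X k = (Σ (EdgeSet X) λ S → IsGlobalForcingSet X S × size {X} S ≡ k) ×
  (∀ S → IsGlobalForcingSet X S → k ≤ size {X} S)
  where open import Data.Nat using (_≤_)

private
  eqb : {k : ℕ} → Fin k → Fin k → Bool
  eqb i j = ⌊ i ≟ j ⌋

  eqb-sym : {k : ℕ} (i j : Fin k) → eqb i j ≡ eqb j i
  eqb-sym i j with i ≟ j | j ≟ i
  ... | yes _ | yes _ = refl
  ... | no _  | no _  = refl
  ... | yes p | no q  = Data.Empty.⊥-elim (q (sym p))
    where import Data.Empty
  ... | no p  | yes q = Data.Empty.⊥-elim (p (sym q))
    where import Data.Empty

  eqb-refl : {k : ℕ} (i : Fin k) → eqb i i ≡ true
  eqb-refl i with i ≟ i
  ... | yes _ = refl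
  ... | no p  = Data.Empty.⊥-elim (p refl)
    where import Data.Empty

module _ (G H : Graph) where
  private
    copy : Fin (n G * n H) → Fin (n G)
    copy x = proj₁ (remQuot {n G} (n H) x)
    vert : Fin (n G * n H) → Fin (n H)
    vert x = proj₂ (remQuot {n G} (n H) x)

  sumAdj : Fin (n G) ⊎ Fin (n G * n H) → Fin (n G) ⊎ Fin (n G * n H) → Bool
  sumAdj (inj₁ g) (inj₁ g') = adj G g g'
  sumAdj (inj₁ g) (inj₂ x)  = eqb g (copy x)
  sumAdj (inj₂ x) (inj₁ g)  = eqb g (copy x)
  sumAdj (inj₂ x) (inj₂ y)  = eqb (copy x) (copy y) ∧ adj H (vert x) (vert y)

  sumAdj-sym : ∀ u v → sumAdj u v ≡ sumAdj v u
  sumAdj-sym (inj₁ g) (inj₁ g') = adj-sym G g g'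
  sumAdj-sym (inj₁ g) (inj₂ x)  = refl
  sumAdj-sym (inj₂ x) (inj₁ g)  = refl
  sumAdj-sym (inj₂ x) (inj₂ y)  = cong₂ _∧_ (eqb-sym (copy x) (copy y)) (adj-sym H (vert x) (vert y))

  sumAdj-irr : ∀ u → sumAdj u u ≡ false
  sumAdj-irr (inj₁ g) = adj-irr G g
  sumAdj-irr (inj₂ x) rewrite adj-irr H (vert x) = ∧-zeroʳ (eqb (copy x) (copy x))

  -- adjacency of G ∘ H: vertices of G are the first n G indices; index
  -- n G + combine i h is vertex h of the copy H_i (joined to g_i)
  coronaAdj : Fin (n G + n G * n H) → Fin (n G + n G * n H) → Bool
  coronaAdj u v = sumAdj (splitAt (n G) u) (splitAt (n G) v)

_∘ᶜ_ : Graph → Graph → Graph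
G ∘ᶜ H = record
  { n = n G + n G * n H
  ; adj = coronaAdj G H
  ; adj-sym = λ u v → sumAdj-sym G H (splitAt (n G) u) (splitAt (n G) v)
  ; adj-irr = λ u → sumAdj-irr G H (splitAt (n G) u)
  }

{-# OPTIONS --safe #-}
module Submission where

-- Fix a minimum global forcing set S of G ∘ H; its edges lie inside G, inside the copies H_i, or are
-- spokes g_i h. Since H is randomly matchable it has perfect matchings, and a maximal matching of G
-- together with perfect matchings of all copies is a maximal matching of G ∘ H. Varying only the part
-- inside G (resp. inside one copy H_i) shows that S ∩ E(G) is a global forcing set of G (resp. that
-- S ∩ E(H_i) is one of H), which accounts for φ(G) + n(G) φ(H) edges. For the spokes: if h₀ h₁ is an
-- edge of H_i with neither g_i h₀ nor g_i h₁ in S, put a perfect matching of H through h₀ h₁ on every copy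
-- and a maximal matching of G - g_i on G; replacing h₀ h₁ in H_i by g_i h₀, or by g_i h₁, gives two different
-- maximal matchings that agree on S. So every edge of a perfect matching of H_i has an end joined to g_i
-- by an edge of S, giving n(H)/2 spokes of S at each g_i.

open import Defs
open import Data.Nat using (ℕ; zero; suc; _+_; _*_; _≤_; _<_; _<ᵇ_; z≤n; s≤s)
open import Data.Nat.Properties
  using ( +-0-commutativeMonoid; +-commutativeSemigroup; +-assoc; +-identityʳ; *-identityʳ; *-zeroʳ; *-distribˡ-+
        ; ≤-trans; ≤-reflexive; m≤m+n; m≤n+m; +-mono-≤; +-monoʳ-≤; *-monoʳ-≤; +-cancelˡ-<; +-monoʳ-<
        ; <-irrefl; <-asym; <-cmp; _<?_; <⇒<ᵇ; module ≤-Reasoning)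
open import Data.Fin using (Fin; zero; suc; toℕ; _≟_; _↑ˡ_; _↑ʳ_; splitAt; join; combine; remQuot)
open import Data.Fin.Properties
  using ( any?; toℕ-injective; toℕ<n; splitAt-↑ˡ; splitAt-↑ʳ; join-splitAt; remQuot-combine; combine-remQuot
        ; toℕ-↑ˡ; toℕ-↑ʳ; toℕ-combine)
open import Data.Fin.Permutation using (permutation)
open import Data.Maybe using (Maybe; just; nothing)
open import Data.Maybe.Properties using (just-injective) renaming (≡-dec to ≡-dec-Maybe)
open import Data.Bool using (Bool; true; false; _∧_; if_then_else_)
open import Data.Bool.Properties using (∧-conicalˡ; ∧-conicalʳ; T-≡) renaming (_≟_ to _≟B_)
open import Data.Product using (Σ; _×_; _,_; ∃; proj₁; proj₂; uncurry)
open import Data.Sum using (_⊎_; inj₁; inj₂)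
open import Data.Empty using (⊥; ⊥-elim)
open import Data.List using (List; []; _∷_; map; allFin; tabulate)
open import Data.List.Properties using (map-tabulate)
open import Data.List.Relation.Unary.All using (All; []; _∷_; lookup)
open import Data.List.Membership.Propositional.Properties using (∈-allFin)
import Data.Nat.ListAction as List
open import Data.Vec.Functional using (updateAt)
open import Data.Vec.Functional.Properties using (updateAt-updates; updateAt-minimal)
open import Function using (_∘_)
open import Function.Bundles using (Equivalence)
open import Relation.Binary using (tri<; tri≈; tri>)
open import Relation.Binary.PropositionalEquality
  using (_≡_; _≢_; refl; sym; trans; cong; cong₂; cong-app; subst; subst₂)
open import Relation.Nullary using (yes; no; Dec)
open import Relation.Nullary.Decidable using (⌊_⌋; _×-dec_)
open import Algebra.Properties.CommutativeMonoid.Sum +-0-commutativeMonoid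
  using (sum; sum-syntax; ∑-distrib-+; sum-cong-≗; sum-permute)
open import Algebra.Properties.CommutativeSemigroup +-commutativeSemigroup using (xy∙z≈xz∙y)

sum-tabulate : ∀ n (f : Fin n → ℕ) → List.sum (tabulate f) ≡ sum f
sum-tabulate zero    f = refl
sum-tabulate (suc n) f = cong (f zero +_) (sum-tabulate n (f ∘ suc))

sum-map-allFin : ∀ n (f : Fin n → ℕ) → List.sum (map f (allFin n)) ≡ sum f
sum-map-allFin n f = trans (cong List.sum (map-tabulate (λ i → i) f)) (sum-tabulate n f)

sum-mono-≤ : ∀ {n} {f g : Fin n → ℕ} → (∀ i → f i ≤ g i) → sum f ≤ sum g
sum-mono-≤ {zero}  f≤g = z≤n
sum-mono-≤ {suc n} f≤g = +-mono-≤ (f≤g zero) (sum-mono-≤ (f≤g ∘ suc))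

≤-sum : ∀ {n} (f : Fin n → ℕ) i → f i ≤ sum f
≤-sum f zero    = m≤m+n _ _
≤-sum f (suc i) = ≤-trans (≤-sum (f ∘ suc) i) (m≤n+m _ _)

sum-const : ∀ n c → ∑[ _ < n ] c ≡ n * c
sum-const zero    c = refl
sum-const (suc n) c = cong (c +_) (sum-const n c)

sum-*ˡ : ∀ {n} c (f : Fin n → ℕ) → ∑[ i < n ] (c * f i) ≡ c * sum f
sum-*ˡ {zero}  c f = sym (*-zeroʳ c)
sum-*ˡ {suc n} c f = trans (cong (c * f zero +_) (sum-*ˡ c (f ∘ suc))) (sym (*-distribˡ-+ c _ _))

sum-↑ : ∀ m k (f : Fin (m + k) → ℕ) → sum f ≡ ∑[ i < m ] f (i ↑ˡ k) + ∑[ j < k ] f (m ↑ʳ j)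
sum-↑ zero    k f = refl
sum-↑ (suc m) k f = trans (cong (f zero +_) (sum-↑ m k (f ∘ suc))) (sym (+-assoc (f zero) _ _))

sum-combine : ∀ m k (f : Fin (m * k) → ℕ) → sum f ≡ ∑[ i < m ] ∑[ j < k ] f (combine i j)
sum-combine zero    k f = refl
sum-combine (suc m) k f =
  trans (sum-↑ k (m * k) f) (cong (∑[ j < k ] f (j ↑ˡ (m * k)) +_) (sum-combine m k (f ∘ (k ↑ʳ_))))

sum-involution : ∀ {n} (σ : Fin n → Fin n) → (∀ x → σ (σ x) ≡ x) →
                 (f : Fin n → ℕ) → ∑[ x < n ] f (σ x) ≡ sum f
sum-involution σ σσ f = sym (sum-permute f (permutation σ σ σσ σσ))

count : ∀ {n} → (Fin n → Bool) → ℕ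
count P = ∑[ x < _ ] (if P x then 1 else 0)

meets-every-pair⇒≤2*count : ∀ n (σ : Fin n → Fin n) → (∀ x → σ (σ x) ≡ x) → (P : Fin n → Bool) →
                            (∀ x → P x ≡ true ⊎ P (σ x) ≡ true) → n ≤ 2 * count P
meets-every-pair⇒≤2*count n σ σσ P meets = begin
  n                                         ≡⟨ trans (sym (*-identityʳ n)) (sym (sum-const n 1)) ⟩
  ∑[ _ < n ] 1                              ≤⟨ sum-mono-≤ pair-counted ⟩
  ∑[ x < n ] (χ x + χ (σ x))                ≡⟨ ∑-distrib-+ χ (χ ∘ σ) ⟩
  count P + ∑[ x < n ] χ (σ x)              ≡⟨ cong (count P +_) (sum-involution σ σσ χ) ⟩
  count P + count P                         ≡⟨ cong (count P +_) (sym (+-identityʳ _)) ⟩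
  2 * count P                               ∎
  where
  open ≤-Reasoning
  χ : Fin n → ℕ
  χ x = if P x then 1 else 0
  pair-counted : ∀ x → 1 ≤ χ x + χ (σ x)
  pair-counted x with meets x
  ... | inj₁ Px  rewrite Px  = s≤s z≤n
  ... | inj₂ Pσx rewrite Pσx = m≤n+m 1 (χ x)

≟-true⇒≡ : ∀ {k} {i j : Fin k} → ⌊ i ≟ j ⌋ ≡ true → i ≡ j
≟-true⇒≡ {i = i} {j} e with i ≟ j
... | yes i≡j = i≡j

≟-refl : ∀ {k} (i : Fin k) → ⌊ i ≟ i ⌋ ≡ true
≟-refl i with i ≟ i
... | yes _  = refl
... | no i≢i = ⊥-elim (i≢i refl)

updateAt-elim : ∀ {A : Set} {k} (P : Fin k → A → Set) (xs : Fin k → A) i {f : A → A} →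
                P i (f (xs i)) → (∀ j → j ≢ i → P j (xs j)) → ∀ j → P j (updateAt xs i f j)
updateAt-elim P xs i Pi Pj j with j ≟ i
... | yes refl = subst (P j) (sym (updateAt-updates j xs)) Pi
... | no j≢i   = subst (P j) (sym (updateAt-minimal j i xs j≢i)) (Pj j j≢i)

Defined : {A : Set} → Maybe A → Set
Defined x = ∃ λ w → x ≡ just w

defined? : {A : Set} (x : Maybe A) → Defined x ⊎ x ≡ nothing
defined? (just x) = inj₁ (x , refl)
defined? nothing  = inj₂ refl

-- A matching is handled through its mate function: m u = just v when uv is a matching edge.
module Mates (X : Graph) where

  Mate : Set
  Mate = Fin (n X) → Maybe (Fin (n X))

  record IsMate (m : Mate) : Set where
    field
      mate-sym : ∀ u v → m u ≡ just v → m v ≡ just u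
      mate-adj : ∀ u v → m u ≡ just v → adj X u v ≡ true
  open IsMate public

  isMate-empty : IsMate (λ _ → nothing)
  isMate-empty = record { mate-sym = λ _ _ () ; mate-adj = λ _ _ () }

  edgesOf : Mate → EdgeSet X
  edgesOf m u v with m u
  ... | just w  = ⌊ w ≟ v ⌋
  ... | nothing = false

  Joins : EdgeSet X → Fin (n X) → Fin (n X) → Set
  Joins S u v = Mem {X} S u v ⊎ Mem {X} S v u

  Joins-sym : ∀ {S u v} → Joins S u v → Joins S v u
  Joins-sym (inj₁ uv) = inj₂ uv
  Joins-sym (inj₂ vu) = inj₁ vu

  Joins-⊆ : ∀ {S T} → _⊆E_ {X} S T → ∀ {u v} → Joins S u v → Joins T u v
  Joins-⊆ S⊆T (inj₁ uv) = inj₁ (S⊆T _ _ uv)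
  Joins-⊆ S⊆T (inj₂ vu) = inj₂ (S⊆T _ _ vu)

  Joins⇒Mem : ∀ {S u v} → Joins S u v → toℕ u < toℕ v → Mem {X} S u v
  Joins⇒Mem (inj₁ uv) u<v = uv
  Joins⇒Mem (inj₂ vu) u<v = ⊥-elim (<-asym u<v (proj₁ vu))

  adj⇒≢ : ∀ {u v} → adj X u v ≡ true → u ≢ v
  adj⇒≢ {u} uv refl with trans (sym uv) (adj-irr X u)
  ... | ()

  Mem-edgesOf : ∀ m {u v} → m u ≡ just v → toℕ u < toℕ v → Mem {X} (edgesOf m) u v
  Mem-edgesOf m {u} {v} muv u<v with m u | muv
  ... | just .v | refl with v ≟ v
  ...   | yes _  = u<v , refl
  ...   | no v≢v = ⊥-elim (v≢v refl)

  edgesOf-Mem : ∀ m {u v} → Mem {X} (edgesOf m) u v → m u ≡ just v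
  edgesOf-Mem m {u} {v} (_ , e) with m u
  ... | just w with w ≟ v
  ...   | yes refl = refl
  edgesOf-Mem m (_ , ()) | just w | no _
  edgesOf-Mem m (_ , ()) | nothing

  module _ {m : Mate} (im : IsMate m) where

    Joins-edgesOf : ∀ {u v} → m u ≡ just v → Joins (edgesOf m) u v
    Joins-edgesOf {u} {v} muv with <-cmp (toℕ u) (toℕ v)
    ... | tri< u<v _ _ = inj₁ (Mem-edgesOf m muv u<v)
    ... | tri≈ _ u≡v _ = ⊥-elim (adj⇒≢ (mate-adj im u v muv) (toℕ-injective u≡v))
    ... | tri> _ _ v<u = inj₂ (Mem-edgesOf m (mate-sym im u v muv) v<u)

    edgesOf-Joins : ∀ {u v} → Joins (edgesOf m) u v → m u ≡ just v
    edgesOf-Joins (inj₁ uv) = edgesOf-Mem m uv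
    edgesOf-Joins (inj₂ vu) = mate-sym im _ _ (edgesOf-Mem m vu)

    isMatching-edgesOf : IsMatching X (edgesOf m)
    isMatching-edgesOf = (λ u v uv → mate-adj im u v (edgesOf-Mem m uv)) , disjoint
      where
      mate-unique : ∀ {u v w} → m u ≡ just v → m u ≡ just w → v ≡ w
      mate-unique muv muw = just-injective (trans (sym muv) muw)
      disjoint : ∀ a b c d → Mem {X} (edgesOf m) a b → Mem {X} (edgesOf m) c d → Share a b c d → (a ≡ c) × (b ≡ d)
      disjoint a b c d ab cd (inj₁ refl) = refl , mate-unique (edgesOf-Mem m ab) (edgesOf-Mem m cd)
      disjoint a b c d ab cd (inj₂ (inj₁ refl)) with mate-unique (edgesOf-Mem m ab) (mate-sym im c a (edgesOf-Mem m cd))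
      ... | refl = ⊥-elim (<-asym (proj₁ ab) (proj₁ cd))
      disjoint a b c d ab cd (inj₂ (inj₂ (inj₁ refl))) with mate-unique (edgesOf-Mem m cd) (mate-sym im a b (edgesOf-Mem m ab))
      ... | refl = ⊥-elim (<-asym (proj₁ ab) (proj₁ cd))
      disjoint a b c d ab cd (inj₂ (inj₂ (inj₂ refl))) =
        mate-unique (mate-sym im a b (edgesOf-Mem m ab)) (mate-sym im c b (edgesOf-Mem m cd)) , refl

  matched-unique : ∀ {M} → IsMatching X M → ∀ {u w w′} → Joins M u w → Joins M u w′ → w ≡ w′
  matched-unique (_ , disj) {u} {w} {w′} (inj₁ uw) (inj₁ uw′) = proj₂ (disj u w u w′ uw uw′ (inj₁ refl))
  matched-unique (_ , disj) {u} {w} {w′} (inj₁ uw) (inj₂ w′u) with disj u w w′ u uw w′u (inj₂ (inj₁ refl))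
  ... | _ , refl = ⊥-elim (<-irrefl refl (proj₁ uw))
  matched-unique (_ , disj) {u} {w} {w′} (inj₂ wu) (inj₁ uw′) =
    let w≡u , u≡w′ = disj w u u w′ wu uw′ (inj₂ (inj₂ (inj₁ refl))) in trans w≡u u≡w′
  matched-unique (_ , disj) {u} {w} {w′} (inj₂ wu) (inj₂ w′u) = proj₁ (disj w u w′ u wu w′u (inj₂ (inj₂ (inj₂ refl))))

  Covers : Mate → Set
  Covers m = ∀ u v → adj X u v ≡ true → Defined (m u) ⊎ Defined (m v)

  isMaximal-edgesOf : ∀ {m} → IsMate m → Covers m → IsMaximalMatching X (edgesOf m)
  isMaximal-edgesOf {m} im covers = isMatching-edgesOf im , maximal
    where
    maximal : ∀ M′ → IsMatching X M′ → _⊆E_ {X} (edgesOf m) M′ → _⊆E_ {X} M′ (edgesOf m)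
    maximal M′ isM′ m⊆M′ i j ij with covers i j (proj₁ isM′ i j ij)
    ... | inj₁ (w , miw) =
      Mem-edgesOf m (trans miw (cong just (matched-unique isM′ (Joins-⊆ m⊆M′ (Joins-edgesOf im miw)) (inj₁ ij)))) (proj₁ ij)
    ... | inj₂ (w , mjw) =
      Mem-edgesOf m (mate-sym im j i (trans mjw (cong just (matched-unique isM′ (Joins-⊆ m⊆M′ (Joins-edgesOf im mjw)) (inj₂ ij))))) (proj₁ ij)

  Joins? : ∀ S u w → Dec (Joins S u w)
  Joins? S u w with (toℕ u <? toℕ w) ×-dec (S u w ≟B true) | (toℕ w <? toℕ u) ×-dec (S w u ≟B true)
  ... | yes uw | _      = yes (inj₁ uw)
  ... | no _   | yes wu = yes (inj₂ wu)
  ... | no ¬uw | no ¬wu = no λ { (inj₁ uw) → ¬uw uw ; (inj₂ wu) → ¬wu wu }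

  mateOf : EdgeSet X → Mate
  mateOf S u with any? (Joins? S u)
  ... | yes (w , _) = just w
  ... | no _        = nothing

  mateOf⇒Joins : ∀ S u {w} → mateOf S u ≡ just w → Joins S u w
  mateOf⇒Joins S u e with any? (Joins? S u)
  mateOf⇒Joins S u refl | yes (w , uw) = uw

  Joins⇒mateOf : ∀ {M} → IsMatching X M → ∀ {u w} → Joins M u w → mateOf M u ≡ just w
  Joins⇒mateOf {M} isM {u} {w} uw with any? (Joins? M u)
  ... | yes (w′ , uw′) = cong just (matched-unique isM uw′ uw)
  ... | no ¬uw         = ⊥-elim (¬uw (w , uw))

  isMate-mateOf : ∀ {M} → IsMatching X M → IsMate (mateOf M)
  isMate-mateOf {M} isM = record
    { mate-sym = λ u v e → Joins⇒mateOf isM (Joins-sym {M} (mateOf⇒Joins M u e))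
    ; mate-adj = λ u v e → joins⇒adj (mateOf⇒Joins M u e) }
    where
    joins⇒adj : ∀ {u v} → Joins M u v → adj X u v ≡ true
    joins⇒adj {u} {v} (inj₁ uv) = proj₁ isM u v uv
    joins⇒adj {u} {v} (inj₂ vu) = trans (adj-sym X u v) (proj₁ isM v u vu)

  addEdge : Mate → Fin (n X) → Fin (n X) → Mate
  addEdge m u v w with w ≟ u | w ≟ v
  ... | yes _ | _     = just v
  ... | no _  | yes _ = just u
  ... | no _  | no _  = m w

  addEdge-at-u : ∀ m u v → addEdge m u v u ≡ just v
  addEdge-at-u m u v with u ≟ u
  ... | yes _  = refl
  ... | no u≢u = ⊥-elim (u≢u refl)

  addEdge-at-v : ∀ m u v → u ≢ v → addEdge m u v v ≡ just u
  addEdge-at-v m u v u≢v with v ≟ u | v ≟ v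
  ... | yes v≡u | _      = ⊥-elim (u≢v (sym v≡u))
  ... | no _    | yes _  = refl
  ... | no _    | no v≢v = ⊥-elim (v≢v refl)

  addEdge-elsewhere : ∀ m u v w → w ≢ u → w ≢ v → addEdge m u v w ≡ m w
  addEdge-elsewhere m u v w w≢u w≢v with w ≟ u | w ≟ v
  ... | yes w≡u | _       = ⊥-elim (w≢u w≡u)
  ... | no _    | yes w≡v = ⊥-elim (w≢v w≡v)
  ... | no _    | no _    = refl

  addEdge-extends : ∀ m u v {w x} → m w ≡ just x → m u ≡ nothing → m v ≡ nothing → addEdge m u v w ≡ just x
  addEdge-extends m u v {w} mwx mu mv = trans (addEdge-elsewhere m u v w (≢-unmatched mwx mu) (≢-unmatched mwx mv)) mwx
    where
    ≢-unmatched : ∀ {w x y} → m w ≡ just x → m y ≡ nothing → w ≢ y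
    ≢-unmatched mwx my refl with trans (sym mwx) my
    ... | ()

  addEdge-cases : ∀ m u v w {x} → addEdge m u v w ≡ just x →
                  (w ≡ u × x ≡ v) ⊎ (w ≡ v × x ≡ u) ⊎ m w ≡ just x
  addEdge-cases m u v w e with w ≟ u | w ≟ v
  addEdge-cases m u v w refl | yes w≡u | _       = inj₁ (w≡u , refl)
  addEdge-cases m u v w refl | no _    | yes w≡v = inj₂ (inj₁ (w≡v , refl))
  addEdge-cases m u v w e    | no _    | no _    = inj₂ (inj₂ e)

  isMate-addEdge : ∀ {m} → IsMate m → ∀ {u v} → m u ≡ nothing → m v ≡ nothing → adj X u v ≡ true →
                   IsMate (addEdge m u v)
  isMate-addEdge {m} im {u} {v} mu mv uv = record { mate-sym = symmetric ; mate-adj = adjacent }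
    where
    symmetric : ∀ w x → addEdge m u v w ≡ just x → addEdge m u v x ≡ just w
    symmetric w x e with addEdge-cases m u v w e
    ... | inj₁ (refl , refl)        = addEdge-at-v m u v (adj⇒≢ uv)
    ... | inj₂ (inj₁ (refl , refl)) = addEdge-at-u m u v
    ... | inj₂ (inj₂ mwx)           = addEdge-extends m u v (mate-sym im w x mwx) mu mv
    adjacent : ∀ w x → addEdge m u v w ≡ just x → adj X w x ≡ true
    adjacent w x e with addEdge-cases m u v w e
    ... | inj₁ (refl , refl)        = uv
    ... | inj₂ (inj₁ (refl , refl)) = trans (adj-sym X v u) uv
    ... | inj₂ (inj₂ mwx)           = mate-adj im w x mwx

  deleteEdge : Mate → Fin (n X) → Fin (n X) → Mate
  deleteEdge m u v w with w ≟ u | w ≟ v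
  ... | yes _ | _     = nothing
  ... | no _  | yes _ = nothing
  ... | no _  | no _  = m w

  deleteEdge-at-u : ∀ m u v → deleteEdge m u v u ≡ nothing
  deleteEdge-at-u m u v with u ≟ u
  ... | yes _  = refl
  ... | no u≢u = ⊥-elim (u≢u refl)

  deleteEdge-at-v : ∀ m u v → deleteEdge m u v v ≡ nothing
  deleteEdge-at-v m u v with v ≟ u | v ≟ v
  ... | yes _ | _      = refl
  ... | no _  | yes _  = refl
  ... | no _  | no v≢v = ⊥-elim (v≢v refl)

  deleteEdge-elsewhere : ∀ m u v w → w ≢ u → w ≢ v → deleteEdge m u v w ≡ m w
  deleteEdge-elsewhere m u v w w≢u w≢v with w ≟ u | w ≟ v
  ... | yes w≡u | _       = ⊥-elim (w≢u w≡u)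
  ... | no _    | yes w≡v = ⊥-elim (w≢v w≡v)
  ... | no _    | no _    = refl

  deleteEdge-just : ∀ m u v w {x} → deleteEdge m u v w ≡ just x → m w ≡ just x × w ≢ u × w ≢ v
  deleteEdge-just m u v w e with w ≟ u | w ≟ v
  deleteEdge-just m u v w () | yes _ | _
  deleteEdge-just m u v w () | no _ | yes _
  deleteEdge-just m u v w e  | no w≢u | no w≢v = e , w≢u , w≢v

  isMate-deleteEdge : ∀ {m} → IsMate m → ∀ {u v} → m u ≡ just v → IsMate (deleteEdge m u v)
  isMate-deleteEdge {m} im {u} {v} muv = record { mate-sym = symmetric ; mate-adj = adjacent }
    where
    symmetric : ∀ w x → deleteEdge m u v w ≡ just x → deleteEdge m u v x ≡ just w
    symmetric w x e with deleteEdge-just m u v w e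
    ... | mwx , w≢u , w≢v = trans (deleteEdge-elsewhere m u v x x≢u x≢v) mxw
      where
      mxw : m x ≡ just w
      mxw = mate-sym im w x mwx
      x≢u : x ≢ u
      x≢u refl = w≢v (just-injective (trans (sym mxw) muv))
      x≢v : x ≢ v
      x≢v refl = w≢u (just-injective (trans (sym mxw) (mate-sym im u v muv)))
    adjacent : ∀ w x → deleteEdge m u v w ≡ just x → adj X w x ≡ true
    adjacent w x e = mate-adj im w x (proj₁ (deleteEdge-just m u v w e))

  isMaximal⇒Covers : ∀ {M} → IsMaximalMatching X M → Covers (mateOf M)
  isMaximal⇒Covers {M} (isM , maximal) u v uv with defined? (mateOf M u) | defined? (mateOf M v)
  ... | inj₁ mu | _       = inj₁ mu
  ... | inj₂ _  | inj₁ mv = inj₂ mv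
  ... | inj₂ mu | inj₂ mv with trans (sym mu) (Joins⇒mateOf isM (Joins-⊆ M′⊆M (Joins-edgesOf im′ (addEdge-at-u m u v))))
    where
    m : Mate
    m = mateOf M
    im′ : IsMate (addEdge m u v)
    im′ = isMate-addEdge (isMate-mateOf isM) mu mv uv
    M⊆M′ : _⊆E_ {X} M (edgesOf (addEdge m u v))
    M⊆M′ i j ij = Mem-edgesOf (addEdge m u v) (addEdge-extends m u v (Joins⇒mateOf isM (inj₁ ij)) mu mv) (proj₁ ij)
    M′⊆M : _⊆E_ {X} (edgesOf (addEdge m u v)) M
    M′⊆M = maximal (edgesOf (addEdge m u v)) (isMatching-edgesOf im′) M⊆M′
  ... | ()

  record MaximalOutside (B : Fin (n X) → Bool) : Set where
    field
      mate    : Mate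
      isMate  : IsMate mate
      avoids  : ∀ u → Defined (mate u) → B u ≡ false
      covers  : ∀ u v → adj X u v ≡ true → Defined (mate u) ⊎ Defined (mate v) ⊎ B u ≡ true ⊎ B v ≡ true

  module Greedy (B : Fin (n X) → Bool) where

    Settled : Mate → Fin (n X) → Set
    Settled m u = Defined (m u) ⊎ B u ≡ true ⊎ (∀ v → adj X u v ≡ true → Defined (m v) ⊎ B v ≡ true)

    Valid : Mate → Set
    Valid m = IsMate m × (∀ u → Defined (m u) → B u ≡ false)

    _≼_ : Mate → Mate → Set
    m ≼ m′ = ∀ w x → m w ≡ just x → m′ w ≡ just x

    Settled-≼ : ∀ {m m′} → m ≼ m′ → ∀ {u} → Settled m u → Settled m′ u
    Settled-≼ m≼m′ (inj₁ (w , e))  = inj₁ (w , m≼m′ _ w e)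
    Settled-≼ m≼m′ (inj₂ (inj₁ b)) = inj₂ (inj₁ b)
    Settled-≼ {m} {m′} m≼m′ (inj₂ (inj₂ f)) = inj₂ (inj₂ λ v uv → lift (f v uv))
      where
      lift : ∀ {v} → Defined (m v) ⊎ B v ≡ true → Defined (m′ v) ⊎ B v ≡ true
      lift (inj₁ (w , e)) = inj₁ (w , m≼m′ _ w e)
      lift (inj₂ b)       = inj₂ b

    Free? : (m : Mate) (u v : Fin (n X)) → Dec (adj X u v ≡ true × m v ≡ nothing × B v ≡ false)
    Free? m u v = (adj X u v ≟B true) ×-dec (≡-dec-Maybe _≟_ (m v) nothing ×-dec (B v ≟B false))

    settle : ∀ m → Valid m → ∀ u → Σ Mate λ m′ → Valid m′ × m ≼ m′ × Settled m′ u
    settle m valid u with m u in mu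
    ... | just w = m , valid , (λ _ _ e → e) , inj₁ (w , mu)
    ... | nothing with B u in bu
    ...   | true = m , valid , (λ _ _ e → e) , inj₂ (inj₁ refl)
    ...   | false with any? (Free? m u)
    ...     | no noFree = m , valid , (λ _ _ e → e) , inj₂ (inj₂ neighbours)
      where
      neighbours : ∀ v → adj X u v ≡ true → Defined (m v) ⊎ B v ≡ true
      neighbours v uv with m v in mv | B v in bv
      ... | just w  | _     = inj₁ (w , refl)
      ... | nothing | true  = inj₂ refl
      ... | nothing | false = ⊥-elim (noFree (v , uv , mv , bv))
    ...     | yes (v , uv , mv , bv) = addEdge m u v , (im′ , avoids′) , extends , inj₁ (v , addEdge-at-u m u v)
      where
      im′ : IsMate (addEdge m u v)
      im′ = isMate-addEdge (proj₁ valid) mu mv uv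
      avoids′ : ∀ w → Defined (addEdge m u v w) → B w ≡ false
      avoids′ w (x , e) with addEdge-cases m u v w e
      ... | inj₁ (refl , _)        = bu
      ... | inj₂ (inj₁ (refl , _)) = bv
      ... | inj₂ (inj₂ mwx)        = proj₂ valid w (x , mwx)
      extends : m ≼ addEdge m u v
      extends w x e = addEdge-extends m u v e mu mv

    settleAll : ∀ (us : List (Fin (n X))) m → Valid m → Σ Mate λ m′ → Valid m′ × m ≼ m′ × All (Settled m′) us
    settleAll []       m valid = m , valid , (λ _ _ e → e) , []
    settleAll (u ∷ us) m valid with settle m valid u
    ... | m₁ , valid₁ , m≼m₁ , settled₁ with settleAll us m₁ valid₁
    ...   | m₂ , valid₂ , m₁≼m₂ , settled₂ =
      m₂ , valid₂ , (λ w x e → m₁≼m₂ w x (m≼m₁ w x e)) , Settled-≼ m₁≼m₂ settled₁ ∷ settled₂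

  maximalOutside : ∀ B → MaximalOutside B
  maximalOutside B with Greedy.settleAll B (allFin (n X)) (λ _ → nothing) (isMate-empty , λ { _ (_ , ()) })
  ... | m , (im , avoids) , _ , settled = record { mate = m ; isMate = im ; avoids = avoids ; covers = covers }
    where
    covers : ∀ u v → adj X u v ≡ true → Defined (m u) ⊎ Defined (m v) ⊎ B u ≡ true ⊎ B v ≡ true
    covers u v uv with lookup settled (∈-allFin u)
    ... | inj₁ mu        = inj₁ mu
    ... | inj₂ (inj₁ bu) = inj₂ (inj₂ (inj₁ bu))
    ... | inj₂ (inj₂ f) with f v uv
    ...   | inj₁ mv = inj₂ (inj₁ mv)
    ...   | inj₂ bv = inj₂ (inj₂ (inj₂ bv))

  maximalOutside-∅-Covers : (M : MaximalOutside (λ _ → false)) → Covers (MaximalOutside.mate M)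
  maximalOutside-∅-Covers M u v uv with MaximalOutside.covers M u v uv
  ... | inj₁ mu                = inj₁ mu
  ... | inj₂ (inj₁ mv)         = inj₂ mv
  ... | inj₂ (inj₂ (inj₁ ()))
  ... | inj₂ (inj₂ (inj₂ ()))

  perfect⇒total : ∀ {P} → IsPerfectMatching X P → ∀ x → Defined (mateOf P x)
  perfect⇒total (isP , covered) x = proj₁ (covered x) , Joins⇒mateOf isP (proj₂ (covered x))

  maximal⇒total : RandomlyMatchable X → ∀ {M} → IsMaximalMatching X M → ∀ x → Defined (mateOf M x)
  maximal⇒total rm {M} (isM , maximal) with rm M isM
  ... | P , (isP , covered) , M⊆P =
    perfect⇒total (isM , λ v → proj₁ (covered v) , Joins-⊆ (maximal P isP M⊆P) (proj₂ (covered v)))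

  record PerfectExtension (m : Mate) : Set where
    field
      mate    : Mate
      isMate  : IsMate mate
      total   : ∀ x → Defined (mate x)
      extends : ∀ u v → m u ≡ just v → mate u ≡ just v

  perfectExtension : RandomlyMatchable X → ∀ {m} → IsMate m → PerfectExtension m
  perfectExtension rm {m} im with rm (edgesOf m) (isMatching-edgesOf im)
  ... | P , perfect , m⊆P = record
    { mate    = mateOf P
    ; isMate  = isMate-mateOf (proj₁ perfect)
    ; total   = perfect⇒total perfect
    ; extends = λ u v muv → Joins⇒mateOf (proj₁ perfect) (Joins-⊆ m⊆P (Joins-edgesOf im muv)) }

  module Partner {m : Mate} (im : IsMate m) (total : ∀ x → Defined (m x)) where
    partner : Fin (n X) → Fin (n X)
    partner x = proj₁ (total x)

    partner-involutive : ∀ x → partner (partner x) ≡ x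
    partner-involutive x =
      just-injective (trans (sym (proj₂ (total (partner x)))) (mate-sym im x (partner x) (proj₂ (total x))))

    partner-adj : ∀ x → adj X x (partner x) ≡ true
    partner-adj x = mate-adj im x (partner x) (proj₂ (total x))

ContainedOn : (Y : Graph) → EdgeSet Y → EdgeSet Y → EdgeSet Y → Set
ContainedOn Y S M M′ = ∀ i j → Mem {Y} S i j → Mem {Y} M i j → Mem {Y} M′ i j

isGlobalForcingSet-by-⊆ : ∀ {Y} S → SubE Y S →
  (∀ {M M′} → IsMaximalMatching Y M → IsMaximalMatching Y M′ →
     ContainedOn Y S M M′ → ContainedOn Y S M′ M → _⊆E_ {Y} M M′) →
  IsGlobalForcingSet Y S
isGlobalForcingSet-by-⊆ S S⊆E included = S⊆E , λ M₁ M₂ max₁ max₂ agree →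
  included max₁ max₂ (λ i j s → proj₁ (agree i j s)) (λ i j s → proj₂ (agree i j s)) ,
  included max₂ max₁ (λ i j s → proj₂ (agree i j s)) (λ i j s → proj₁ (agree i j s))

module Corona (G H : Graph) where

  X : Graph
  X = G ∘ᶜ H

  module MG = Mates G
  module MH = Mates H
  module MX = Mates X

  data Vertex : Set where
    base : Fin (n G) → Vertex
    copy : Fin (n G) → Fin (n H) → Vertex

  encode : Vertex → Fin (n X)
  encode (base g)   = g ↑ˡ (n G * n H)
  encode (copy i h) = n G ↑ʳ combine i h

  fromSplit : Fin (n G) ⊎ Fin (n G * n H) → Vertex
  fromSplit (inj₁ g) = base g
  fromSplit (inj₂ x) = uncurry copy (remQuot (n H) x)

  decode : Fin (n X) → Vertex
  decode u = fromSplit (splitAt (n G) u)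

  decode-encode : ∀ a → decode (encode a) ≡ a
  decode-encode (base g) rewrite splitAt-↑ˡ (n G) g (n G * n H) = refl
  decode-encode (copy i h) rewrite splitAt-↑ʳ (n G) (n G * n H) (combine i h) =
    cong (uncurry copy) (remQuot-combine {n G} {n H} i h)

  encode-decode : ∀ u → encode (decode u) ≡ u
  encode-decode u = trans (encode-fromSplit (splitAt (n G) u)) (join-splitAt (n G) (n G * n H) u)
    where
    encode-fromSplit : ∀ s → encode (fromSplit s) ≡ join (n G) (n G * n H) s
    encode-fromSplit (inj₁ g) = refl
    encode-fromSplit (inj₂ x) = cong (n G ↑ʳ_) (combine-remQuot {n G} (n H) x)

  adj-base-base : ∀ g g′ → adj X (encode (base g)) (encode (base g′)) ≡ adj G g g′
  adj-base-base g g′ rewrite splitAt-↑ˡ (n G) g (n G * n H) | splitAt-↑ˡ (n G) g′ (n G * n H) = refl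

  adj-base-copy : ∀ g i h → adj X (encode (base g)) (encode (copy i h)) ≡ ⌊ g ≟ i ⌋
  adj-base-copy g i h rewrite splitAt-↑ˡ (n G) g (n G * n H) | splitAt-↑ʳ (n G) (n G * n H) (combine i h) =
    cong (λ p → ⌊ g ≟ proj₁ p ⌋) (remQuot-combine {n G} {n H} i h)

  adj-copy-base : ∀ g i h → adj X (encode (copy i h)) (encode (base g)) ≡ ⌊ g ≟ i ⌋
  adj-copy-base g i h = trans (adj-sym X _ _) (adj-base-copy g i h)

  adj-copy-copy : ∀ i h j h′ → adj X (encode (copy i h)) (encode (copy j h′)) ≡ (⌊ i ≟ j ⌋ ∧ adj H h h′)
  adj-copy-copy i h j h′
    rewrite splitAt-↑ʳ (n G) (n G * n H) (combine i h) | splitAt-↑ʳ (n G) (n G * n H) (combine j h′) =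
    cong₂ (λ p q → ⌊ proj₁ p ≟ proj₁ q ⌋ ∧ adj H (proj₂ p) (proj₂ q))
          (remQuot-combine {n G} {n H} i h) (remQuot-combine {n G} {n H} j h′)

  toℕ-base : ∀ g → toℕ (encode (base g)) ≡ toℕ g
  toℕ-base g = toℕ-↑ˡ g (n G * n H)

  toℕ-copy : ∀ i h → toℕ (encode (copy i h)) ≡ n G + (n H * toℕ i + toℕ h)
  toℕ-copy i h = trans (toℕ-↑ʳ (n G) (combine i h)) (cong (n G +_) (toℕ-combine i h))

  base<copy : ∀ g i h → toℕ (encode (base g)) < toℕ (encode (copy i h))
  base<copy g i h rewrite toℕ-base g | toℕ-copy i h = ≤-trans (toℕ<n g) (m≤m+n (n G) _)

  copy≮base : ∀ g i h → toℕ (encode (copy i h)) < toℕ (encode (base g)) → ⊥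
  copy≮base g i h lt = <-asym lt (base<copy g i h)

  copy<copy⇔ : ∀ i h h′ → (toℕ (encode (copy i h)) < toℕ (encode (copy i h′)) → toℕ h < toℕ h′) ×
                           (toℕ h < toℕ h′ → toℕ (encode (copy i h)) < toℕ (encode (copy i h′)))
  copy<copy⇔ i h h′ rewrite toℕ-copy i h | toℕ-copy i h′ =
    (λ lt → +-cancelˡ-< (n H * toℕ i) _ _ (+-cancelˡ-< (n G) _ _ lt)) ,
    (λ lt → +-monoʳ-< (n G) (+-monoʳ-< (n H * toℕ i) lt))

  at-decoded : ∀ (R : Fin (n X) → Fin (n X) → Set) {u v} → R (encode (decode u)) (encode (decode v)) → R u v
  at-decoded R {u} {v} = subst₂ R (encode-decode u) (encode-decode v)

  at-encoded : ∀ (R : Fin (n X) → Fin (n X) → Set) {u v} → R u v → R (encode (decode u)) (encode (decode v))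
  at-encoded R {u} {v} = subst₂ R (sym (encode-decode u)) (sym (encode-decode v))

  BaseMatched : MG.Mate → (Fin (n G) → Maybe (Fin (n H))) → Fin (n G) → Set
  BaseMatched onG spoke g = Defined (onG g) ⊎ Defined (spoke g)

  CopyMatched : MH.Mate → Maybe (Fin (n H)) → Fin (n H) → Set
  CopyMatched onCopyᵢ spokeᵢ h = Defined (onCopyᵢ h) ⊎ spokeᵢ ≡ just h

  -- A maximal matching of G ∘ H given piecewise: its edges inside G, its edges inside each copy H_i,
  -- and the spoke g_i h of H_i it contains, if any; the covering fields say that it meets every edge.
  record Split : Set where
    field
      onG            : MG.Mate
      onG-mate       : MG.IsMate onG
      onCopy         : Fin (n G) → MH.Mate
      onCopy-mate    : ∀ i → MH.IsMate (onCopy i)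
      spoke          : Fin (n G) → Maybe (Fin (n H))
      spoke-freeG    : ∀ i h → spoke i ≡ just h → onG i ≡ nothing
      spoke-freeCopy : ∀ i h → spoke i ≡ just h → onCopy i h ≡ nothing
      covers-G       : ∀ g g′ → adj G g g′ ≡ true → BaseMatched onG spoke g ⊎ BaseMatched onG spoke g′
      covers-copy    : ∀ i h h′ → adj H h h′ ≡ true →
                       CopyMatched (onCopy i) (spoke i) h ⊎ CopyMatched (onCopy i) (spoke i) h′
      covers-spoke   : ∀ i h → BaseMatched onG spoke i ⊎ CopyMatched (onCopy i) (spoke i) h

  module SplitMate (P : Split) where
    open Split P

    baseMate : Maybe (Fin (n G)) → Maybe (Fin (n H)) → Fin (n G) → Maybe Vertex
    baseMate (just g′) _        g = just (base g′)
    baseMate nothing   (just h) g = just (copy g h)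
    baseMate nothing   nothing  g = nothing

    copyMate : Maybe (Fin (n H)) → Maybe (Fin (n H)) → Fin (n G) → Fin (n H) → Maybe Vertex
    copyMate (just h′) _         i h = just (copy i h′)
    copyMate nothing   (just h″) i h = if ⌊ h″ ≟ h ⌋ then just (base i) else nothing
    copyMate nothing   nothing   i h = nothing

    mateV : Vertex → Maybe Vertex
    mateV (base g)   = baseMate (onG g) (spoke g) g
    mateV (copy i h) = copyMate (onCopy i h) (spoke i) i h

    data Edge : Vertex → Vertex → Set where
      inG      : ∀ g g′ → onG g ≡ just g′ → Edge (base g) (base g′)
      inCopy   : ∀ i h h′ → onCopy i h ≡ just h′ → Edge (copy i h) (copy i h′)
      spokeOut : ∀ i h → onG i ≡ nothing → spoke i ≡ just h → Edge (base i) (copy i h)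
      spokeIn  : ∀ i h → onCopy i h ≡ nothing → spoke i ≡ just h → Edge (copy i h) (base i)

    mateV⇒Edge : ∀ a b → mateV a ≡ just b → Edge a b
    mateV⇒Edge (base g) b e with onG g in eG
    mateV⇒Edge (base g) b refl | just g′ = inG g g′ eG
    ... | nothing with spoke g in eS
    mateV⇒Edge (base g) b refl | nothing | just h = spokeOut g h eG eS
    mateV⇒Edge (copy i h) b e with onCopy i h in eC
    mateV⇒Edge (copy i h) b refl | just h′ = inCopy i h h′ eC
    ... | nothing with spoke i in eS
    ... | just h″ with h″ ≟ h
    mateV⇒Edge (copy i h) b refl | nothing | just h″ | yes refl = spokeIn i h eC eS

    Edge⇒mateV : ∀ {a b} → Edge a b → mateV a ≡ just b
    Edge⇒mateV (inG g g′ e) rewrite e = refl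
    Edge⇒mateV (inCopy i h h′ e) rewrite e = refl
    Edge⇒mateV (spokeOut i h eG eS) rewrite eG | eS = refl
    Edge⇒mateV (spokeIn i h eC eS) rewrite eC | eS | ≟-refl h = refl

    Edge-sym : ∀ {a b} → Edge a b → Edge b a
    Edge-sym (inG g g′ e)        = inG g′ g (MG.mate-sym onG-mate g g′ e)
    Edge-sym (inCopy i h h′ e)   = inCopy i h′ h (MH.mate-sym (onCopy-mate i) h h′ e)
    Edge-sym (spokeOut i h _ eS) = spokeIn i h (spoke-freeCopy i h eS) eS
    Edge-sym (spokeIn i h _ eS)  = spokeOut i h (spoke-freeG i h eS) eS

    Edge-adj : ∀ {a b} → Edge a b → adj X (encode a) (encode b) ≡ true
    Edge-adj (inG g g′ e)      = trans (adj-base-base g g′) (MG.mate-adj onG-mate g g′ e)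
    Edge-adj (inCopy i h h′ e) =
      trans (adj-copy-copy i h i h′) (subst (λ b → (b ∧ adj H h h′) ≡ true) (sym (≟-refl i))
                                            (MH.mate-adj (onCopy-mate i) h h′ e))
    Edge-adj (spokeOut i h _ _) = trans (adj-base-copy i i h) (≟-refl i)
    Edge-adj (spokeIn i h _ _)  = trans (adj-copy-base i i h) (≟-refl i)

    base-matched : ∀ g → BaseMatched onG spoke g → Defined (mateV (base g))
    base-matched g (inj₁ (g′ , e)) = base g′ , Edge⇒mateV (inG g g′ e)
    base-matched g (inj₂ (h , eS)) with defined? (onG g)
    ... | inj₁ (g′ , e) = base g′ , Edge⇒mateV (inG g g′ e)
    ... | inj₂ e        = copy g h , Edge⇒mateV (spokeOut g h e eS)

    copy-matched : ∀ i h → CopyMatched (onCopy i) (spoke i) h → Defined (mateV (copy i h))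
    copy-matched i h (inj₁ (h′ , e)) = copy i h′ , Edge⇒mateV (inCopy i h h′ e)
    copy-matched i h (inj₂ eS) with defined? (onCopy i h)
    ... | inj₁ (h′ , e) = copy i h′ , Edge⇒mateV (inCopy i h h′ e)
    ... | inj₂ e        = base i , Edge⇒mateV (spokeIn i h e eS)

    mateV-covers : ∀ a b → adj X (encode a) (encode b) ≡ true → Defined (mateV a) ⊎ Defined (mateV b)
    mateV-covers (base g) (base g′) e with covers-G g g′ (trans (sym (adj-base-base g g′)) e)
    ... | inj₁ m = inj₁ (base-matched g m)
    ... | inj₂ m = inj₂ (base-matched g′ m)
    mateV-covers (base g) (copy i h) e with ≟-true⇒≡ (trans (sym (adj-base-copy g i h)) e)
    ... | refl with covers-spoke g h
    ...   | inj₁ m = inj₁ (base-matched g m)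
    ...   | inj₂ m = inj₂ (copy-matched g h m)
    mateV-covers (copy i h) (base g) e with ≟-true⇒≡ (trans (sym (adj-copy-base g i h)) e)
    ... | refl with covers-spoke g h
    ...   | inj₁ m = inj₂ (base-matched g m)
    ...   | inj₂ m = inj₁ (copy-matched g h m)
    mateV-covers (copy i h) (copy j h′) e with ≟-true⇒≡ (∧-conicalˡ ⌊ i ≟ j ⌋ (adj H h h′) (trans (sym (adj-copy-copy i h j h′)) e))
    ... | refl with covers-copy i h h′ (∧-conicalʳ ⌊ i ≟ i ⌋ (adj H h h′) (trans (sym (adj-copy-copy i h i h′)) e))
    ...   | inj₁ m = inj₁ (copy-matched i h m)
    ...   | inj₂ m = inj₂ (copy-matched i h′ m)

    mate : MX.Mate
    mate u = Data.Maybe.map encode (mateV (decode u))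

    Edge⇒mate : ∀ {a b} → Edge a b → mate (encode a) ≡ just (encode b)
    Edge⇒mate {a} e rewrite decode-encode a | Edge⇒mateV e = refl

    mate⇒Edge : ∀ {u v} → mate u ≡ just v → Edge (decode u) (decode v)
    mate⇒Edge {u} e with mateV (decode u) in eV
    mate⇒Edge {u} refl | just b = subst (Edge (decode u)) (sym (decode-encode b)) (mateV⇒Edge _ _ eV)

    mate-encode⇒Edge : ∀ {a b} → mate (encode a) ≡ just (encode b) → Edge a b
    mate-encode⇒Edge {a} {b} e = subst₂ Edge (decode-encode a) (decode-encode b) (mate⇒Edge e)

    isMate : MX.IsMate mate
    isMate = record
      { mate-sym = λ u v e → at-decoded (λ x y → mate x ≡ just y) (Edge⇒mate (Edge-sym (mate⇒Edge e)))
      ; mate-adj = λ u v e → at-decoded (λ x y → adj X x y ≡ true) (Edge-adj (mate⇒Edge e)) }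

    covers : MX.Covers mate
    covers u v uv with mateV-covers (decode u) (decode v) (at-encoded (λ x y → adj X x y ≡ true) uv)
    ... | inj₁ (b , e) = inj₁ (encode b , cong (Data.Maybe.map encode) e)
    ... | inj₂ (b , e) = inj₂ (encode b , cong (Data.Maybe.map encode) e)

    isMaximal : IsMaximalMatching X (MX.edgesOf mate)
    isMaximal = MX.isMaximal-edgesOf isMate covers

    Edge⇒Mem : ∀ {a b} → Edge a b → toℕ (encode a) < toℕ (encode b) → Mem {X} (MX.edgesOf mate) (encode a) (encode b)
    Edge⇒Mem e = MX.Mem-edgesOf mate (Edge⇒mate e)

    Mem⇒Edge : ∀ {u v} → Mem {X} (MX.edgesOf mate) u v → Edge (decode u) (decode v)
    Mem⇒Edge m = mate⇒Edge (MX.edgesOf-Mem mate m)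

  PreservedOn : EdgeSet X → Split → Split → Set
  PreservedOn S P Q = ∀ a b → Mem {X} S (encode a) (encode b) → SplitMate.Edge P a b → SplitMate.Edge Q a b

  preserved⇒⊆ : ∀ {S} P Q → PreservedOn S P Q → ∀ u v → Mem {X} S u v →
                Mem {X} (MX.edgesOf (SplitMate.mate P)) u v → Mem {X} (MX.edgesOf (SplitMate.mate Q)) u v
  preserved⇒⊆ {S} P Q preserved u v s m =
    at-decoded (Mem {X} (MX.edgesOf (SplitMate.mate Q)))
      (SplitMate.Edge⇒Mem Q (preserved _ _ s′ (SplitMate.Mem⇒Edge P m)) (proj₁ s′))
    where
    s′ : Mem {X} S (encode (decode u)) (encode (decode v))
    s′ = at-encoded (Mem {X} S) s

  forced-Edge : ∀ {S} → IsGlobalForcingSet X S → ∀ P Q → PreservedOn S P Q → PreservedOn S Q P →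
                ∀ {a b} → SplitMate.Edge P a b → SplitMate.Edge Q a b
  forced-Edge (_ , forcing) P Q P→Q Q→P e =
    Q.mate-encode⇒Edge (MX.edgesOf-Joins Q.isMate (MX.Joins-⊆ (proj₁ same) (MX.Joins-edgesOf P.isMate (P.Edge⇒mate e))))
    where
    module P = SplitMate P
    module Q = SplitMate Q
    same : SameE {X} (MX.edgesOf P.mate) (MX.edgesOf Q.mate)
    same = forcing _ _ P.isMaximal Q.isMaximal λ u v s → preserved⇒⊆ P Q P→Q u v s , preserved⇒⊆ Q P Q→P u v s

  restrictG : EdgeSet X → EdgeSet G
  restrictG S g g′ = S (encode (base g)) (encode (base g′))

  restrictCopy : EdgeSet X → Fin (n G) → EdgeSet H
  restrictCopy S i h h′ = S (encode (copy i h)) (encode (copy i h′))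

  spokesIn : EdgeSet X → Fin (n G) → Fin (n H) → Bool
  spokesIn S i h = S (encode (base i)) (encode (copy i h))

  Mem-restrictG⁺ : ∀ {S g g′} → Mem {X} S (encode (base g)) (encode (base g′)) → Mem {G} (restrictG S) g g′
  Mem-restrictG⁺ {g = g} {g′} (lt , s) = subst₂ _<_ (toℕ-base g) (toℕ-base g′) lt , s

  Mem-restrictG⁻ : ∀ {S g g′} → Mem {G} (restrictG S) g g′ → Mem {X} S (encode (base g)) (encode (base g′))
  Mem-restrictG⁻ {g = g} {g′} (lt , s) = subst₂ _<_ (sym (toℕ-base g)) (sym (toℕ-base g′)) lt , s

  Mem-restrictCopy⁺ : ∀ {S i h h′} → Mem {X} S (encode (copy i h)) (encode (copy i h′)) → Mem {H} (restrictCopy S i) h h′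
  Mem-restrictCopy⁺ {i = i} {h} {h′} (lt , s) = proj₁ (copy<copy⇔ i h h′) lt , s

  Mem-restrictCopy⁻ : ∀ {S i h h′} → Mem {H} (restrictCopy S i) h h′ → Mem {X} S (encode (copy i h)) (encode (copy i h′))
  Mem-restrictCopy⁻ {i = i} {h} {h′} (lt , s) = proj₂ (copy<copy⇔ i h h′) lt , s

  restrictG⊆E : ∀ {S} → SubE X S → SubE G (restrictG S)
  restrictG⊆E {S} S⊆E g g′ m = trans (sym (adj-base-base g g′)) (S⊆E _ _ (Mem-restrictG⁻ {S} m))

  restrictCopy⊆E : ∀ {S} → SubE X S → ∀ i → SubE H (restrictCopy S i)
  restrictCopy⊆E {S} S⊆E i h h′ m =
    ∧-conicalʳ ⌊ i ≟ i ⌋ (adj H h h′) (trans (sym (adj-copy-copy i h i h′)) (S⊆E _ _ (Mem-restrictCopy⁻ {S} m)))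

  splitWithoutSpokes : (onG : MG.Mate) → MG.IsMate onG → MG.Covers onG →
                       (onCopy : Fin (n G) → MH.Mate) → (∀ i → MH.IsMate (onCopy i)) → (∀ i h → Defined (onCopy i h)) →
                       Split
  splitWithoutSpokes onG onG-mate onG-covers onCopy onCopy-mate onCopy-total = record
    { onG = onG ; onG-mate = onG-mate ; onCopy = onCopy ; onCopy-mate = onCopy-mate ; spoke = λ _ → nothing
    ; spoke-freeG = λ _ _ () ; spoke-freeCopy = λ _ _ ()
    ; covers-G     = λ g g′ gg′ → Data.Sum.map inj₁ inj₁ (onG-covers g g′ gg′)
    ; covers-copy  = λ i h h′ _ → inj₁ (inj₁ (onCopy-total i h))
    ; covers-spoke = λ i h → inj₂ (inj₁ (onCopy-total i h)) }

module CoronaForcing (G H : Graph) (rm : RandomlyMatchable H) where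

  open Corona G H
  open SplitMate using (Edge; inG; inCopy; spokeOut; spokeIn)

  perfectH : MH.PerfectExtension (λ _ → nothing)
  perfectH = MH.perfectExtension rm MH.isMate-empty

  module P₀ = MH.PerfectExtension perfectH

  module _ {S : EdgeSet X} (forcing : IsGlobalForcingSet X S) where

    fromG : ∀ {M} → IsMaximalMatching G M → Split
    fromG {M} max = splitWithoutSpokes (MG.mateOf M) (MG.isMate-mateOf (proj₁ max)) (MG.isMaximal⇒Covers max)
                                       (λ _ → P₀.mate) (λ _ → P₀.isMate) (λ _ → P₀.total)

    fromG-preserved : ∀ {M M′} (max : IsMaximalMatching G M) (max′ : IsMaximalMatching G M′) →
                      ContainedOn G (restrictG S) M M′ → PreservedOn S (fromG max) (fromG max′)
    fromG-preserved {M} max max′ M⊆M′ _ _ s (inG g g′ e) =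
      inG g g′ (MG.Joins⇒mateOf (proj₁ max′) (inj₁ (M⊆M′ g g′ s′ (MG.Joins⇒Mem {M} (MG.mateOf⇒Joins M g e) (proj₁ s′)))))
      where
      s′ : Mem {G} (restrictG S) g g′
      s′ = Mem-restrictG⁺ {S} s
    fromG-preserved max max′ M⊆M′ _ _ s (inCopy i h h′ e) = inCopy i h h′ e

    restrictG-isGlobalForcingSet : IsGlobalForcingSet G (restrictG S)
    restrictG-isGlobalForcingSet = isGlobalForcingSet-by-⊆ {G} (restrictG S) (restrictG⊆E {S} (proj₁ forcing)) included
      where
      included : ∀ {M M′} → IsMaximalMatching G M → IsMaximalMatching G M′ →
                 ContainedOn G (restrictG S) M M′ → ContainedOn G (restrictG S) M′ M → _⊆E_ {G} M M′
      included {M} {M′} max max′ M⊆M′ M′⊆M g g′ gg′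
        with forced-Edge forcing (fromG max) (fromG max′) (fromG-preserved max max′ M⊆M′) (fromG-preserved max′ max M′⊆M)
                         (inG g g′ (MG.Joins⇒mateOf (proj₁ max) (inj₁ gg′)))
      ... | inG _ _ e = MG.Joins⇒Mem {M′} (MG.mateOf⇒Joins M′ g e) (proj₁ gg′)

    maximalG : MG.MaximalOutside (λ _ → false)
    maximalG = MG.maximalOutside (λ _ → false)

    module _ (i : Fin (n G)) where

      copies : MH.Mate → Fin (n G) → MH.Mate
      copies q = updateAt (λ _ → P₀.mate) i (λ _ → q)

      copies-isMate : ∀ {q} → MH.IsMate q → ∀ j → MH.IsMate (copies q j)
      copies-isMate {q} isMate = updateAt-elim (λ _ → MH.IsMate) (λ _ → P₀.mate) i {λ _ → q} isMate (λ _ _ → P₀.isMate)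

      copies-total : ∀ {q} → (∀ h → Defined (q h)) → ∀ j h → Defined (copies q j h)
      copies-total {q} total = updateAt-elim (λ _ q → ∀ h → Defined (q h)) (λ _ → P₀.mate) i {λ _ → q} total (λ _ _ → P₀.total)

      copies-at : ∀ q h → copies q i h ≡ q h
      copies-at q h = cong-app (updateAt-updates i _) h

      copies-elsewhere : ∀ q {j} → j ≢ i → ∀ h → copies q j h ≡ P₀.mate h
      copies-elsewhere q {j} j≢i h = cong-app (updateAt-minimal j i _ j≢i) h

      fromCopy : ∀ {M} → IsMaximalMatching H M → Split
      fromCopy {M} max =
        splitWithoutSpokes (MG.MaximalOutside.mate maximalG) (MG.MaximalOutside.isMate maximalG)
                           (MG.maximalOutside-∅-Covers maximalG) (copies (MH.mateOf M))
                           (copies-isMate (MH.isMate-mateOf (proj₁ max))) (copies-total (MH.maximal⇒total rm max))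

      fromCopy-preserved : ∀ {M M′} (max : IsMaximalMatching H M) (max′ : IsMaximalMatching H M′) →
                           ContainedOn H (restrictCopy S i) M M′ → PreservedOn S (fromCopy max) (fromCopy max′)
      fromCopy-preserved max max′ M⊆M′ _ _ s (inG g g′ e) = inG g g′ e
      fromCopy-preserved {M} {M′} max max′ M⊆M′ _ _ s (inCopy j h h′ e) with j ≟ i
      ... | no j≢i   = inCopy j h h′ (trans (copies-elsewhere _ j≢i h) (trans (sym (copies-elsewhere _ j≢i h)) e))
      ... | yes refl = inCopy j h h′ (trans (copies-at _ h) (MH.Joins⇒mateOf (proj₁ max′) (inj₁ hh′∈M′)))
        where
        s′ : Mem {H} (restrictCopy S j) h h′
        s′ = Mem-restrictCopy⁺ {S} s
        hh′∈M′ : Mem {H} M′ h h′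
        hh′∈M′ = M⊆M′ h h′ s′ (MH.Joins⇒Mem {M} (MH.mateOf⇒Joins M h (trans (sym (copies-at _ h)) e)) (proj₁ s′))

      restrictCopy-isGlobalForcingSet : IsGlobalForcingSet H (restrictCopy S i)
      restrictCopy-isGlobalForcingSet =
        isGlobalForcingSet-by-⊆ {H} (restrictCopy S i) (restrictCopy⊆E {S} (proj₁ forcing) i) included
        where
        included : ∀ {M M′} → IsMaximalMatching H M → IsMaximalMatching H M′ →
                   ContainedOn H (restrictCopy S i) M M′ → ContainedOn H (restrictCopy S i) M′ M → _⊆E_ {H} M M′
        included {M} {M′} max max′ M⊆M′ M′⊆M h h′ hh′
          with forced-Edge forcing (fromCopy max) (fromCopy max′)
                           (fromCopy-preserved max max′ M⊆M′) (fromCopy-preserved max′ max M′⊆M)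
                           (inCopy i h h′ (trans (copies-at _ h) (MH.Joins⇒mateOf (proj₁ max) (inj₁ hh′))))
        ... | inCopy _ _ _ e = MH.Joins⇒Mem {M′} (MH.mateOf⇒Joins M′ h (trans (sym (copies-at _ h)) e)) (proj₁ hh′)

    module _ (i : Fin (n G)) {h₀ h₁ : Fin (n H)} (h₀h₁ : adj H h₀ h₁ ≡ true) where

      avoiding : MG.MaximalOutside (λ g → ⌊ g ≟ i ⌋)
      avoiding = MG.maximalOutside (λ g → ⌊ g ≟ i ⌋)

      module Avoiding = MG.MaximalOutside avoiding

      avoiding-i : Avoiding.mate i ≡ nothing
      avoiding-i with defined? (Avoiding.mate i)
      ... | inj₂ e = e
      ... | inj₁ d with trans (sym (≟-refl i)) (Avoiding.avoids i d)
      ...   | ()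

      throughEdge : MH.PerfectExtension (MH.addEdge (λ _ → nothing) h₀ h₁)
      throughEdge = MH.perfectExtension rm (MH.isMate-addEdge MH.isMate-empty refl refl h₀h₁)

      module ThroughEdge = MH.PerfectExtension throughEdge

      copiesC : Fin (n G) → MH.Mate
      copiesC = updateAt (λ _ → ThroughEdge.mate) i (λ q → MH.deleteEdge q h₀ h₁)

      copiesC-isMate : ∀ j → MH.IsMate (copiesC j)
      copiesC-isMate = updateAt-elim (λ _ → MH.IsMate) (λ _ → ThroughEdge.mate) i
        (MH.isMate-deleteEdge ThroughEdge.isMate (ThroughEdge.extends h₀ h₁ (MH.addEdge-at-u _ h₀ h₁)))
        (λ _ _ → ThroughEdge.isMate)

      spokeTo : Fin (n H) → Fin (n G) → Maybe (Fin (n H))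
      spokeTo k = updateAt (λ _ → nothing) i (λ _ → just k)

      spokeTo-i : ∀ k → spokeTo k i ≡ just k
      spokeTo-i k = updateAt-updates i (λ _ → nothing)

      spokeTo-just : ∀ k j {h} → spokeTo k j ≡ just h → j ≡ i × h ≡ k
      spokeTo-just k j e with j ≟ i
      ... | yes refl = refl , just-injective (trans (sym e) (spokeTo-i k))
      ... | no j≢i with trans (sym e) (updateAt-minimal j i (λ _ → nothing) j≢i)
      ...   | ()

      Endpoints : Fin (n H) → Fin (n H) → Set
      Endpoints k o = (k ≡ h₀ × o ≡ h₁) ⊎ (k ≡ h₁ × o ≡ h₀)

      copiesC-k : ∀ {k o} → Endpoints k o → copiesC i k ≡ nothing
      copiesC-k (inj₁ (refl , _)) = trans (cong-app (updateAt-updates i _) h₀) (MH.deleteEdge-at-u _ h₀ h₁)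
      copiesC-k (inj₂ (refl , _)) = trans (cong-app (updateAt-updates i _) h₁) (MH.deleteEdge-at-v _ h₀ h₁)

      not-endpoint : ∀ {k o h} → Endpoints k o → h ≢ k → h ≢ o → h ≢ h₀ × h ≢ h₁
      not-endpoint (inj₁ (refl , refl)) h≢k h≢o = h≢k , h≢o
      not-endpoint (inj₂ (refl , refl)) h≢k h≢o = h≢o , h≢k

      module _ {k o : Fin (n H)} (ends : Endpoints k o) where

        -- In copy i only the endpoint o of the deleted edge stays unmatched.
        copy-matched : ∀ j h → (j ≡ i → h ≢ o) → CopyMatched (copiesC j) (spokeTo k j) h
        copy-matched j h h≢o with j ≟ i
        ... | no j≢i = inj₁ (subst Defined (sym (cong-app (updateAt-minimal j i _ j≢i) h)) (ThroughEdge.total h))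
        ... | yes refl with h ≟ k
        ...   | yes refl = inj₂ (spokeTo-i h)
        ...   | no h≢k = inj₁ (subst Defined (sym (trans (cong-app (updateAt-updates j _) h)
                                                         (MH.deleteEdge-elsewhere _ h₀ h₁ h h≢h₀ h≢h₁)))
                                          (ThroughEdge.total h))
          where
          h≢h₀ : h ≢ h₀
          h≢h₀ = proj₁ (not-endpoint ends h≢k (h≢o refl))
          h≢h₁ : h ≢ h₁
          h≢h₁ = proj₂ (not-endpoint ends h≢k (h≢o refl))

        withSpoke : Split
        withSpoke = record
          { onG = Avoiding.mate ; onG-mate = Avoiding.isMate ; onCopy = copiesC ; onCopy-mate = copiesC-isMate
          ; spoke = spokeTo k
          ; spoke-freeG    = λ j h e → subst (λ j → Avoiding.mate j ≡ nothing) (sym (proj₁ (spokeTo-just k j e))) avoiding-i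
          ; spoke-freeCopy = λ j h e → spoke-free (spokeTo-just k j e)
          ; covers-G = coversG ; covers-copy = coversCopy ; covers-spoke = coversSpoke }
          where
          spoke-free : ∀ {j h} → j ≡ i × h ≡ k → copiesC j h ≡ nothing
          spoke-free (refl , refl) = copiesC-k ends
          blocked : ∀ {g} → ⌊ g ≟ i ⌋ ≡ true → BaseMatched Avoiding.mate (spokeTo k) g
          blocked b with ≟-true⇒≡ b
          ... | refl = inj₂ (k , spokeTo-i k)
          coversG : ∀ g g′ → adj G g g′ ≡ true → BaseMatched Avoiding.mate (spokeTo k) g ⊎ BaseMatched Avoiding.mate (spokeTo k) g′
          coversG g g′ gg′ with Avoiding.covers g g′ gg′
          ... | inj₁ d                = inj₁ (inj₁ d)
          ... | inj₂ (inj₁ d)         = inj₂ (inj₁ d)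
          ... | inj₂ (inj₂ (inj₁ b))  = inj₁ (blocked b)
          ... | inj₂ (inj₂ (inj₂ b))  = inj₂ (blocked b)
          coversCopy : ∀ j h h′ → adj H h h′ ≡ true →
                       CopyMatched (copiesC j) (spokeTo k j) h ⊎ CopyMatched (copiesC j) (spokeTo k j) h′
          coversCopy j h h′ hh′ with h ≟ o
          ... | no h≢o   = inj₁ (copy-matched j h (λ _ → h≢o))
          ... | yes refl = inj₂ (copy-matched j h′ (λ _ h′≡h → MH.adj⇒≢ hh′ (sym h′≡h)))
          coversSpoke : ∀ j h → BaseMatched Avoiding.mate (spokeTo k) j ⊎ CopyMatched (copiesC j) (spokeTo k j) h
          coversSpoke j h with j ≟ i
          ... | yes refl = inj₁ (inj₂ (k , spokeTo-i k))
          ... | no j≢i   = inj₂ (copy-matched j h (λ j≡i → ⊥-elim (j≢i j≡i)))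

      withSpoke-preserved : ∀ {k o k′ o′} (ends : Endpoints k o) (ends′ : Endpoints k′ o′) → spokesIn S i k ≡ false →
                            PreservedOn S (withSpoke ends) (withSpoke ends′)
      withSpoke-preserved ends ends′ k∉S _ _ s (inG g g′ e)      = inG g g′ e
      withSpoke-preserved ends ends′ k∉S _ _ s (inCopy j h h′ e) = inCopy j h h′ e
      withSpoke-preserved ends ends′ k∉S _ _ s (spokeIn j h _ _) = ⊥-elim (copy≮base j j h (proj₁ s))
      withSpoke-preserved {k} ends ends′ k∉S _ _ s (spokeOut j h _ e) with spokeTo-just k j e
      ... | refl , refl with trans (sym (proj₂ s)) k∉S
      ...   | ()

      adjacent-spokes-in : spokesIn S i h₀ ≡ true ⊎ spokesIn S i h₁ ≡ true
      adjacent-spokes-in with spokesIn S i h₀ in s₀ | spokesIn S i h₁ in s₁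
      ... | true  | _     = inj₁ refl
      ... | false | true  = inj₂ refl
      ... | false | false
        with forced-Edge forcing (withSpoke ends₀) (withSpoke ends₁)
                         (withSpoke-preserved ends₀ ends₁ s₀) (withSpoke-preserved ends₁ ends₀ s₁)
                         (spokeOut i h₀ avoiding-i (spokeTo-i h₀))
        where
        ends₀ : Endpoints h₀ h₁
        ends₀ = inj₁ (refl , refl)
        ends₁ : Endpoints h₁ h₀
        ends₁ = inj₂ (refl , refl)
      ...   | spokeOut _ _ _ e = ⊥-elim (MH.adj⇒≢ h₀h₁ (proj₂ (spokeTo-just h₁ i e)))

    n≤2*count-spokesIn : ∀ i → n H ≤ 2 * count (spokesIn S i)
    n≤2*count-spokesIn i =
      meets-every-pair⇒≤2*count (n H) partner partner-involutive (spokesIn S i) (λ h → adjacent-spokes-in i (partner-adj h))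
      where open MH.Partner P₀.isMate P₀.total

    n*φ≤∑size-restrictCopy : ∀ {b} → (∀ T → IsGlobalForcingSet H T → b ≤ size {H} T) →
                             n G * b ≤ ∑[ i < n G ] size {H} (restrictCopy S i)
    n*φ≤∑size-restrictCopy {b} b-min = ≤-trans (≤-reflexive (sym (sum-const (n G) b)))
                                               (sum-mono-≤ λ i → b-min _ (restrictCopy-isGlobalForcingSet i))

    n*n≤2*∑count-spokesIn : n G * n H ≤ 2 * ∑[ i < n G ] count (spokesIn S i)
    n*n≤2*∑count-spokesIn = begin
      n G * n H                                 ≡⟨ sym (sum-const (n G) (n H)) ⟩
      ∑[ i < n G ] n H                          ≤⟨ sum-mono-≤ n≤2*count-spokesIn ⟩
      ∑[ i < n G ] (2 * count (spokesIn S i))   ≡⟨ sum-*ˡ 2 (λ i → count (spokesIn S i)) ⟩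
      2 * ∑[ i < n G ] count (spokesIn S i)     ∎
      where open ≤-Reasoning

indicator : {Y : Graph} → EdgeSet Y → Fin (n Y) → Fin (n Y) → ℕ
indicator S u v = if (toℕ u <ᵇ toℕ v) ∧ S u v then 1 else 0

size≡∑∑ : ∀ Y (S : EdgeSet Y) → size {Y} S ≡ ∑[ u < n Y ] ∑[ v < n Y ] indicator {Y} S u v
size≡∑∑ Y S = trans (sum-map-allFin (n Y) _) (sum-cong-≗ (λ u → sum-map-allFin (n Y) (indicator {Y} S u)))

+-<ᵇ-cancelˡ : ∀ a b c → (a + b <ᵇ a + c) ≡ (b <ᵇ c)
+-<ᵇ-cancelˡ zero    b c = refl
+-<ᵇ-cancelˡ (suc a) b c = +-<ᵇ-cancelˡ a b c

module CoronaCount (G H : Graph) (S : EdgeSet (G ∘ᶜ H)) where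

  open Corona G H

  I : Vertex → Vertex → ℕ
  I a b = indicator {X} S (encode a) (encode b)

  row : Fin (n X) → ℕ
  row u = ∑[ v < n X ] indicator {X} S u v

  ∑-vertices : (f : Fin (n X) → ℕ) → sum f ≡ ∑[ g < n G ] f (encode (base g)) + ∑[ i < n G ] ∑[ h < n H ] f (encode (copy i h))
  ∑-vertices f = trans (sum-↑ (n G) (n G * n H) f) (cong (∑[ g < n G ] f (encode (base g)) +_) (sum-combine (n G) (n H) _))

  I-base-base : ∀ g g′ → I (base g) (base g′) ≡ indicator {G} (restrictG S) g g′
  I-base-base g g′ = cong (λ b → if b ∧ restrictG S g g′ then 1 else 0) (cong₂ _<ᵇ_ (toℕ-base g) (toℕ-base g′))

  I-spoke : ∀ g h → I (base g) (copy g h) ≡ (if spokesIn S g h then 1 else 0)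
  I-spoke g h = cong (λ b → if b ∧ spokesIn S g h then 1 else 0) (Equivalence.to T-≡ (<⇒<ᵇ (base<copy g g h)))

  I-copy-copy : ∀ i h h′ → I (copy i h) (copy i h′) ≡ indicator {H} (restrictCopy S i) h h′
  I-copy-copy i h h′ = cong (λ b → if b ∧ restrictCopy S i h h′ then 1 else 0)
    (trans (cong₂ _<ᵇ_ (toℕ-copy i h) (toℕ-copy i h′)) (trans (+-<ᵇ-cancelˡ (n G) _ _) (+-<ᵇ-cancelˡ (n H * toℕ i) _ _)))

  base-row : ∀ g → ∑[ g′ < n G ] I (base g) (base g′) + ∑[ h < n H ] I (base g) (copy g h) ≤ row (encode (base g))
  base-row g = begin
    ∑[ g′ < n G ] I (base g) (base g′) + ∑[ h < n H ] I (base g) (copy g h)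
      ≤⟨ +-monoʳ-≤ (∑[ g′ < n G ] I (base g) (base g′)) (≤-sum (λ j → ∑[ h < n H ] I (base g) (copy j h)) g) ⟩
    ∑[ g′ < n G ] I (base g) (base g′) + ∑[ j < n G ] ∑[ h < n H ] I (base g) (copy j h)
      ≡⟨ sym (∑-vertices (indicator {X} S (encode (base g)))) ⟩
    row (encode (base g)) ∎
    where open ≤-Reasoning

  copy-row : ∀ i h → ∑[ h′ < n H ] I (copy i h) (copy i h′) ≤ row (encode (copy i h))
  copy-row i h = begin
    ∑[ h′ < n H ] I (copy i h) (copy i h′)
      ≤⟨ ≤-sum (λ j → ∑[ h′ < n H ] I (copy i h) (copy j h′)) i ⟩
    ∑[ j < n G ] ∑[ h′ < n H ] I (copy i h) (copy j h′)
      ≤⟨ m≤n+m _ _ ⟩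
    ∑[ g < n G ] I (copy i h) (base g) + ∑[ j < n G ] ∑[ h′ < n H ] I (copy i h) (copy j h′)
      ≡⟨ sym (∑-vertices (indicator {X} S (encode (copy i h)))) ⟩
    row (encode (copy i h)) ∎
    where open ≤-Reasoning

  size-parts≤size : size {G} (restrictG S) + ∑[ i < n G ] size {H} (restrictCopy S i) + ∑[ i < n G ] count (spokesIn S i)
                    ≤ size {X} S
  size-parts≤size = begin
    size {G} (restrictG S) + ∑[ i < n G ] size {H} (restrictCopy S i) + ∑[ i < n G ] count (spokesIn S i)
      ≡⟨ cong₂ _+_ (cong₂ _+_ G-part copy-part) spoke-part ⟩
    inG + inCopies + spokes
      ≡⟨ xy∙z≈xz∙y inG inCopies spokes ⟩
    inG + spokes + inCopies
      ≡⟨ cong (_+ inCopies) (sym (∑-distrib-+ (λ g → ∑[ g′ < n G ] I (base g) (base g′)) (λ g → ∑[ h < n H ] I (base g) (copy g h)))) ⟩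
    ∑[ g < n G ] (∑[ g′ < n G ] I (base g) (base g′) + ∑[ h < n H ] I (base g) (copy g h)) + inCopies
      ≤⟨ +-mono-≤ (sum-mono-≤ base-row) (sum-mono-≤ λ i → sum-mono-≤ λ h → copy-row i h) ⟩
    ∑[ g < n G ] row (encode (base g)) + ∑[ i < n G ] ∑[ h < n H ] row (encode (copy i h))
      ≡⟨ sym (trans (size≡∑∑ X S) (∑-vertices row)) ⟩
    size {X} S ∎
    where
    open ≤-Reasoning
    inG inCopies spokes : ℕ
    inG      = ∑[ g < n G ] ∑[ g′ < n G ] I (base g) (base g′)
    inCopies = ∑[ i < n G ] ∑[ h < n H ] ∑[ h′ < n H ] I (copy i h) (copy i h′)
    spokes   = ∑[ g < n G ] ∑[ h < n H ] I (base g) (copy g h)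
    G-part : size {G} (restrictG S) ≡ inG
    G-part = trans (size≡∑∑ G (restrictG S)) (sum-cong-≗ λ g → sum-cong-≗ λ g′ → sym (I-base-base g g′))
    copy-part : ∑[ i < n G ] size {H} (restrictCopy S i) ≡ inCopies
    copy-part = sum-cong-≗ λ i → trans (size≡∑∑ H (restrictCopy S i)) (sum-cong-≗ λ h → sum-cong-≗ λ h′ → sym (I-copy-copy i h h′))
    spoke-part : ∑[ i < n G ] count (spokesIn S i) ≡ spokes
    spoke-part = sum-cong-≗ λ g → sum-cong-≗ λ h → sym (I-spoke g h)

mainTheorem4 : (G H : Graph) → RandomlyMatchable H →
    (a b c : ℕ) → IsPhiGm G a → IsPhiGm H b → IsPhiGm (G ∘ᶜ H) c →
    2 * a + 2 * (n G * b) + n G * n H ≤ 2 * c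
mainTheorem4 G H rm a b c (_ , a-min) (_ , b-min) ((S , forcing , |S|≡c) , _) = begin
  2 * a + 2 * (n G * b) + n G * n H
    ≤⟨ +-mono-≤ (+-mono-≤ (*-monoʳ-≤ 2 (a-min _ (restrictG-isGlobalForcingSet forcing)))
                         (*-monoʳ-≤ 2 (n*φ≤∑size-restrictCopy forcing b-min)))
                (n*n≤2*∑count-spokesIn forcing) ⟩
  2 * inG + 2 * inCopies + 2 * spokes
    ≡⟨ sym (trans (*-distribˡ-+ 2 (inG + inCopies) spokes) (cong (_+ 2 * spokes) (*-distribˡ-+ 2 inG inCopies))) ⟩
  2 * (inG + inCopies + spokes)
    ≤⟨ *-monoʳ-≤ 2 (CoronaCount.size-parts≤size G H S) ⟩
  2 * size {G ∘ᶜ H} S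
    ≡⟨ cong (2 *_) |S|≡c ⟩
  2 * c ∎
  where
  open ≤-Reasoning
  open Corona G H using (restrictG; restrictCopy; spokesIn)
  open CoronaForcing G H rm
  inG inCopies spokes : ℕ
  inG      = size {G} (restrictG S)
  inCopies = ∑[ i < n G ] size {H} (restrictCopy S i)
  spokes   = ∑[ i < n G ] count (spokesIn S i)
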